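{- Let $\langle M,\mathsf{bind},\mathsf{unit},\diamond,\varnothing\rangle$ be an execution model, $\Sigma$ a set of states, and $\vDash$ the (classical) outcome assertion satisfaction relation over $M\Sigma$. For any $m,m'\in M\Sigma$ and atomic assertion $P$: if $m\vDash^\downarrow P$ and $m\preccurlyeq m'$, then $m'\vDash^\downarrow P$.
   Context: An execution model is a monad $\langle M,\mathsf{bind},\mathsf{unit}\rangle$ on sets such that each $\langle MA,\diamond,\varnothing\rangle$ is a partial commutative monoid with $\mathsf{bind}(m_1\diamond m_2,k)=\mathsf{bind}(m_1,k)\diamond\mathsf{bind}(m_2,k)$ and $\mathsf{bind}(\varnothing,k)=\varnothing$. Outcome assertions over $M\Sigma$ (with atomic assertions $\mathsf{Prop}$ and a relation $\vDash_{\mathsf{atom}}\subseteq M\Sigma\times\mathsf{Prop}$): $m\vDash\top$ always; $m\vDash\varphi\oplus\psi$ iff $m=m_1\diamond m_2$ for some $m_1\vDash\varphi$, $m_2\vDash\psi$; $m\vDash P$ iff $m\vDash_{\mathsf{atom}}P$. Under-approximate satisfaction: $m\vDash^\downarrow\varphi$ iff $m\vDash\varphi\oplus\top$. Preorder: $m_1\preccurlyeq m_2$ iff either $m_1=\varnothing$ and $m_2=\varnothing$, or $m_1\ne\varnothing$ and there is $m$ with $m_1\diamond m=m_2$. -}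

module Defs where

open import Level using (Level; suc; _⊔_)
open import Data.Maybe using (Maybe; just; nothing)
open import Data.Product using (Σ; ∃; ∃-syntax; _×_; _,_)
open import Data.Sum using (_⊎_)
open import Relation.Binary.PropositionalEquality using (_≡_)
open import Relation.Nullary using (¬_)

-- A partial commutative monoid ⟨ A , ⋄ , ∅ ⟩ where the partial operation is
-- rendered as a Maybe-valued total function ( nothing = undefined ).
-- Equalities between partial expressions are Kleene equalities
-- (both undefined, or both defined and equal).
record IsPCM (A : Set) (_⋄_ : A → A → Maybe A) (∅ : A) : Set where
  field
    ⋄-identityˡ : ∀ a → ∅ ⋄ a ≡ just a
    ⋄-comm      : ∀ a b → a ⋄ b ≡ b ⋄ a
    ⋄-assoc     : ∀ a b c ab abc →
                  a ⋄ b ≡ just ab → ab ⋄ c ≡ just abc →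
                  ∃[ bc ] (b ⋄ c ≡ just bc × a ⋄ bc ≡ just abc)
    ⋄-assoc'    : ∀ a b c bc abc →
                  b ⋄ c ≡ just bc → a ⋄ bc ≡ just abc →
                  ∃[ ab ] (a ⋄ b ≡ just ab × ab ⋄ c ≡ just abc)

record ExecutionModel : Set₁ where
  field
    M    : Set → Set
    bind : {A B : Set} → M A → (A → M B) → M B
    unit : {A : Set} → A → M A
    bind-unitˡ : {A B : Set} (a : A) (k : A → M B) → bind (unit a) k ≡ k a
    bind-unitʳ : {A : Set} (m : M A) → bind m unit ≡ m
    bind-assoc : {A B C : Set} (m : M A) (k : A → M B) (h : B → M C) →
                 bind (bind m k) h ≡ bind m (λ a → bind (k a) h)
    _⋄_  : {A : Set} → M A → M A → Maybe (M A)
    ∅    : {A : Set} → M A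
    isPCM : {A : Set} → IsPCM (M A) _⋄_ ∅
    bind-⋄ : {A B : Set} (m₁ m₂ m : M A) (k : A → M B) →
             m₁ ⋄ m₂ ≡ just m →
             bind m₁ k ⋄ bind m₂ k ≡ just (bind m k)
    bind-∅ : {A B : Set} (k : A → M B) → bind ∅ k ≡ ∅

module Outcome (E : ExecutionModel) (Σ' : Set) (Prop : Set)
               (_⊨atom_ : ExecutionModel.M E Σ' → Prop → Set) where
  open ExecutionModel E

  data Assertion : Set where
    ⊤ₐ   : Assertion
    _⊕_  : Assertion → Assertion → Assertion
    atom : Prop → Assertion

  _⊨_ : M Σ' → Assertion → Set
  m ⊨ ⊤ₐ = Data.Unit.Polymorphic.⊤
    where import Data.Unit.Polymorphic
  m ⊨ (φ ⊕ ψ) = ∃[ m₁ ] ∃[ m₂ ] (m₁ ⋄ m₂ ≡ just m × m₁ ⊨ φ × m₂ ⊨ ψ)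
  m ⊨ atom P = m ⊨atom P

  _⊨↓_ : M Σ' → Assertion → Set
  m ⊨↓ φ = m ⊨ (φ ⊕ ⊤ₐ)

  _≼_ : M Σ' → M Σ' → Set
  m₁ ≼ m₂ = (m₁ ≡ ∅ × m₂ ≡ ∅) ⊎ (¬ (m₁ ≡ ∅) × ∃[ m ] (m₁ ⋄ m ≡ just m₂))

module Submission where

open import Defs
open import Data.Maybe using (just)
open import Data.Product using (_,_)
open import Data.Sum using (inj₁; inj₂)
open import Data.Unit.Polymorphic using (tt)
open import Relation.Binary.PropositionalEquality using (_≡_; refl)

-- Absorbing extra outcomes into the ⊤ component is associativity of ⋄;
-- the case m ≡ ∅ ≡ m' of the preorder is trivial.

module UnderApproximation (E : ExecutionModel) (Σ' Prop : Set)
                          (_⊨atom_ : ExecutionModel.M E Σ' → Prop → Set) where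
  open ExecutionModel E
  open Outcome E Σ' Prop _⊨atom_

  ⊨↓-⋄-closed : ∀ {m k m'} φ → m ⋄ k ≡ just m' → m ⊨↓ φ → m' ⊨↓ φ
  ⊨↓-⋄-closed {k = k} {m'} φ m⋄k≡m' (m₁ , m₂ , m₁⋄m₂≡m , m₁⊨φ , _)
    with IsPCM.⋄-assoc isPCM m₁ m₂ k _ m' m₁⋄m₂≡m m⋄k≡m'
  ... | m₂k , _ , m₁⋄m₂k≡m' = m₁ , m₂k , m₁⋄m₂k≡m' , m₁⊨φ , tt

  ⊨↓-≼-mono : ∀ {m m'} φ → m ⊨↓ φ → m ≼ m' → m' ⊨↓ φ
  ⊨↓-≼-mono φ m⊨↓φ (inj₁ (refl , refl)) = m⊨↓φ
  ⊨↓-≼-mono φ m⊨↓φ (inj₂ (_ , k , m⋄k≡m')) = ⊨↓-⋄-closed φ m⋄k≡m' m⊨↓φ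

lemmaB3 : (E : ExecutionModel) (Σ' : Set) (Prop : Set)
          (_⊨atom_ : ExecutionModel.M E Σ' → Prop → Set)
          (m m' : ExecutionModel.M E Σ') (P : Prop) →
          Outcome._⊨↓_ E Σ' Prop _⊨atom_ m (Outcome.atom P) →
          Outcome._≼_ E Σ' Prop _⊨atom_ m m' →
          Outcome._⊨↓_ E Σ' Prop _⊨atom_ m' (Outcome.atom P)
lemmaB3 E Σ' Prop _⊨atom_ m m' P =
  UnderApproximation.⊨↓-≼-mono E Σ' Prop _⊨atom_ (Outcome.atom P)
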